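{- Let $n\ge 3$ and let $PDF_n$ be the digraph on vertex set $\{1,2,\ldots,n\}$ with arcs: $(t,t+1)$ for $2\le t\le n-1$; $(1,i)$ for every $1\le i\le n$ (including a self loop at vertex $1$); and $(n,1)$. Then $$\Psi_{PDF_n}(x)=x^n-\sum_{i=1}^{n}x^{n-i}.$$
   Context: The characteristic polynomial $\Psi_X(x)$ of a digraph $X$ is $\det(xI-A)$, where $A$ is the adjacency matrix of $X$ (the $(i,j)$ entry is the number of arcs from $i$ to $j$; a self loop at $i$ contributes $1$ to the $(i,i)$ entry). -}

module Defs where

open import Data.Nat as ℕ using (ℕ; zero; suc; _∸_)
open import Data.Integer as ℤ using (ℤ; +_; 0ℤ; 1ℤ)
open import Data.Fin using (Fin; zero; suc; toℕ; punchIn; _≟_)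
open import Data.List using (List; []; _∷_; _++_; map; length; filter)
open import Data.List.Relation.Unary.All using (All)
open import Data.Product using (_×_; _,_)
open import Relation.Binary.PropositionalEquality using (_≡_)
open import Relation.Nullary using (yes; no; does)
open import Data.Bool using (if_then_else_)
import Data.Nat.Properties as ℕP
import Data.Product.Properties as ×P

-- Polynomials over ℤ in one variable x, as coefficient lists
-- (constant coefficient first).  Equality is "the difference has all
-- coefficients zero".

Poly : Set
Poly = List ℤ

const : ℤ → Poly
const a = a ∷ []

X : Poly
X = 0ℤ ∷ 1ℤ ∷ []

infixl 6 _+ₚ_ _-ₚ_
infixl 7 _*ₚ_ _·ₚ_

_+ₚ_ : Poly → Poly → Poly
[] +ₚ q = q
(a ∷ p) +ₚ [] = a ∷ p
(a ∷ p) +ₚ (b ∷ q) = (a ℤ.+ b) ∷ (p +ₚ q)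

_·ₚ_ : ℤ → Poly → Poly
a ·ₚ q = map (a ℤ.*_) q

-ₚ_ : Poly → Poly
-ₚ p = map ℤ.-_ p

_-ₚ_ : Poly → Poly → Poly
p -ₚ q = p +ₚ (-ₚ q)

_*ₚ_ : Poly → Poly → Poly
[] *ₚ q = []
(a ∷ p) *ₚ q = (a ·ₚ q) +ₚ (0ℤ ∷ (p *ₚ q))

_^ₚ_ : Poly → ℕ → Poly
p ^ₚ zero = const 1ℤ
p ^ₚ suc k = p *ₚ (p ^ₚ k)

infix 4 _≈ₚ_
_≈ₚ_ : Poly → Poly → Set
p ≈ₚ q = All (_≡ 0ℤ) (p -ₚ q)

ΣFin : ∀ {n} → (Fin n → Poly) → Poly
ΣFin {zero} f = []
ΣFin {suc n} f = f zero +ₚ ΣFin (λ i → f (suc i))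

range : ℕ → ℕ → List ℕ   -- range a k = [a, a+1, …, a+k-1]
range a zero = []
range a (suc k) = a ∷ range (suc a) k

ΣList : List ℕ → (ℕ → Poly) → Poly
ΣList [] f = []
ΣList (i ∷ is) f = f i +ₚ ΣList is f

sign : ℕ → Poly
sign zero = const 1ℤ
sign (suc zero) = const (ℤ.- 1ℤ)
sign (suc (suc k)) = sign k

det : ∀ {n} → (Fin n → Fin n → Poly) → Poly
det {zero} M = const 1ℤ
det {suc n} M =
  ΣFin (λ j → sign (toℕ j) *ₚ M zero j *ₚ det (λ r c → M (suc r) (punchIn j c)))

-- Digraphs on {1,…,n}, given by their multiset (list) of arcs (i , j),
-- with vertices labelled 1,…,n.  A self loop is an arc (i , i).

record Digraph (n : ℕ) : Set where
  field arcs : List (ℕ × ℕ)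

-- adjacency matrix: (i,j) entry = number of arcs from vertex i+1 to j+1
-- (Fin n is 0-based, vertices are 1-based)
adj : ∀ {n} → Digraph n → Fin n → Fin n → ℕ
adj G i j =
  length (filter (λ e → ×P.≡-dec ℕP._≟_ ℕP._≟_ e (suc (toℕ i) , suc (toℕ j)))
                 (Digraph.arcs G))

charPoly : ∀ {n} → Digraph n → Poly
charPoly G = det (λ i j →
  (if does (i ≟ j) then X else []) -ₚ const (+ adj G i j))

PDF : (n : ℕ) → Digraph n
PDF n = record { arcs =
     map (λ t → (t , suc t)) (range 2 (n ∸ 2))      -- (t,t+1), 2 ≤ t ≤ n-1
  ++ map (λ i → (1 , i)) (range 1 n)                -- (1,i),   1 ≤ i ≤ n
  ++ ((n , 1) ∷ []) }

-- Label the vertices 0, …, T with T = n − 1.  The matrix xI − A has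
-- row 0 equal to (x − 1, −1, …, −1); row i, for 1 ≤ i < T, has x in
-- column i and −1 in column i + 1; row T has −1 in column 0 and x in
-- column T.  Expand the determinant along row 0 (this is how  det  is
-- defined):
--   * deleting column 0 leaves an upper triangular matrix with diagonal x,
--     so this term is (x − 1)·xᵀ;
--   * deleting column d + 1 leaves a matrix whose determinant is
--     (−1)^(d+1)·xᵈ (peel it off row by row, always along a row or column
--     with a single nonzero entry); with the cofactor sign and the entry
--     −1 this term is −xᵈ.
-- Hence the determinant is (x − 1)·xᵀ − (1 + x + ⋯ + x^{T−1}), which
-- telescopes to xⁿ − (1 + x + ⋯ + x^{n−1}).

module Submission where

open import Defs
open import Data.Nat using (ℕ; _≥_; _∸_)
open import Data.Nat as ℕ using (zero; suc; _≤_; _<_; s≤s; z≤n)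
import Data.Nat.Properties as ℕP
open import Data.Integer as ℤ using (ℤ; +_; 0ℤ; 1ℤ; -1ℤ)
import Data.Integer.Properties as ℤP
open import Data.Integer.Tactic.RingSolver using (solve-∀)
open import Data.Fin as Fin using (Fin; toℕ; punchIn; punchOut)
import Data.Fin.Properties as FinP
open import Data.List using (List; []; _∷_; _++_; map; length; filter; replicate)
import Data.List.Properties as ListP
open import Data.List.Relation.Unary.All using (All; []; _∷_)
open import Data.Product using (_×_; _,_; proj₁; proj₂)
open import Data.Product.Properties using (≡-dec)
open import Data.Empty using (⊥-elim)
open import Function using (_∘_)
open import Data.Sum using (inj₁; inj₂)
open import Data.Bool using (if_then_else_)
open import Relation.Nullary using (yes; no; does)
open import Relation.Nullary.Decidable using (dec-true; dec-false)
open import Relation.Binary.PropositionalEquality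
open import Relation.Binary.Bundles using (Setoid)
open import Level using (0ℓ)
import Relation.Binary.Reasoning.Setoid as SetoidReasoning

-- Coefficient semantics of coefficient lists.  Two polynomials are
-- identified when all their coefficients agree; this is the equality
-- in which all the algebra below is done.

coeff : Poly → ℕ → ℤ
coeff []      k       = 0ℤ
coeff (a ∷ p) zero    = a
coeff (a ∷ p) (suc k) = coeff p k

infix 4 _≋_
record _≋_ (p q : Poly) : Set where
  constructor mk≋
  field coeff-≡ : ∀ k → coeff p k ≡ coeff q k
open _≋_

≋-refl : ∀ {p} → p ≋ p
≋-refl = mk≋ λ k → refl

≋-sym : ∀ {p q} → p ≋ q → q ≋ p
≋-sym e = mk≋ λ k → sym (coeff-≡ e k)

≋-trans : ∀ {p q r} → p ≋ q → q ≋ r → p ≋ r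
≋-trans e f = mk≋ λ k → trans (coeff-≡ e k) (coeff-≡ f k)

≡⇒≋ : ∀ {p q} → p ≡ q → p ≋ q
≡⇒≋ refl = ≋-refl

≋-setoid : Setoid 0ℓ 0ℓ
≋-setoid = record
  { Carrier = Poly ; _≈_ = _≋_
  ; isEquivalence = record { refl = ≋-refl ; sym = ≋-sym ; trans = ≋-trans } }

module ≋-Reasoning = SetoidReasoning ≋-setoid

coeff-+ : ∀ p q k → coeff (p +ₚ q) k ≡ coeff p k ℤ.+ coeff q k
coeff-+ []      q       k       = sym (ℤP.+-identityˡ _)
coeff-+ (a ∷ p) []      k       = sym (ℤP.+-identityʳ _)
coeff-+ (a ∷ p) (b ∷ q) zero    = refl
coeff-+ (a ∷ p) (b ∷ q) (suc k) = coeff-+ p q k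

coeff-· : ∀ a q k → coeff (a ·ₚ q) k ≡ a ℤ.* coeff q k
coeff-· a []      k       = sym (ℤP.*-zeroʳ a)
coeff-· a (b ∷ q) zero    = refl
coeff-· a (b ∷ q) (suc k) = coeff-· a q k

coeff-neg : ∀ q k → coeff (-ₚ q) k ≡ ℤ.- coeff q k
coeff-neg []      k       = refl
coeff-neg (b ∷ q) zero    = refl
coeff-neg (b ∷ q) (suc k) = coeff-neg q k

coeff-- : ∀ p q k → coeff (p -ₚ q) k ≡ coeff p k ℤ.- coeff q k
coeff-- p q k = trans (coeff-+ p (-ₚ q) k) (cong (ℤ._+_ (coeff p k)) (coeff-neg q k))

≋⇒≈ₚ : ∀ {p q} → p ≋ q → p ≈ₚ q
≋⇒≈ₚ {p} {q} e = allZero (p -ₚ q) λ k → begin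
    coeff (p -ₚ q) k          ≡⟨ coeff-- p q k ⟩
    coeff p k ℤ.- coeff q k   ≡⟨ cong (ℤ._- coeff q k) (coeff-≡ e k) ⟩
    coeff q k ℤ.- coeff q k   ≡⟨ ℤP.+-inverseʳ (coeff q k) ⟩
    0ℤ                        ∎
  where
  open ≡-Reasoning
  allZero : ∀ r → (∀ k → coeff r k ≡ 0ℤ) → All (_≡ 0ℤ) r
  allZero []      h = []
  allZero (a ∷ r) h = h zero ∷ allZero r (λ k → h (suc k))

∷-cong : ∀ {a b p q} → a ≡ b → p ≋ q → (a ∷ p) ≋ (b ∷ q)
∷-cong a≡b p≋q = mk≋ λ { zero → a≡b ; (suc k) → coeff-≡ p≋q k }

∷-split : ∀ {a b p q} → (a ∷ p) ≋ (b ∷ q) → a ≡ b × p ≋ q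
∷-split e = coeff-≡ e zero , mk≋ λ k → coeff-≡ e (suc k)

∷-vanish : ∀ {a p} → (a ∷ p) ≋ [] → a ≡ 0ℤ × p ≋ []
∷-vanish e = coeff-≡ e zero , mk≋ λ k → coeff-≡ e (suc k)

+-cong : ∀ {p p′ q q′} → p ≋ p′ → q ≋ q′ → p +ₚ q ≋ p′ +ₚ q′
+-cong {p} {p′} {q} {q′} e f = mk≋ λ k → begin
    coeff (p +ₚ q) k            ≡⟨ coeff-+ p q k ⟩
    coeff p k ℤ.+ coeff q k     ≡⟨ cong₂ ℤ._+_ (coeff-≡ e k) (coeff-≡ f k) ⟩
    coeff p′ k ℤ.+ coeff q′ k   ≡⟨ coeff-+ p′ q′ k ⟨
    coeff (p′ +ₚ q′) k          ∎
  where open ≡-Reasoning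

·-cong : ∀ a {q q′} → q ≋ q′ → a ·ₚ q ≋ a ·ₚ q′
·-cong a {q} {q′} e = mk≋ λ k →
  trans (coeff-· a q k) (trans (cong (a ℤ.*_) (coeff-≡ e k)) (sym (coeff-· a q′ k)))

neg-cong : ∀ {p p′} → p ≋ p′ → -ₚ p ≋ -ₚ p′
neg-cong {p} {p′} e = mk≋ λ k →
  trans (coeff-neg p k) (trans (cong ℤ.-_ (coeff-≡ e k)) (sym (coeff-neg p′ k)))

+-identityʳ : ∀ p → p +ₚ [] ≡ p
+-identityʳ []      = refl
+-identityʳ (a ∷ p) = refl

zero-const : const 0ℤ ≋ []
zero-const = mk≋ λ { zero → refl ; (suc k) → refl }

·-zeroˡ : ∀ q → 0ℤ ·ₚ q ≋ []
·-zeroˡ q = mk≋ λ k → trans (coeff-· 0ℤ q k) (ℤP.*-zeroˡ (coeff q k))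

·-identityˡ : ∀ q → 1ℤ ·ₚ q ≋ q
·-identityˡ q = mk≋ λ k → trans (coeff-· 1ℤ q k) (ℤP.*-identityˡ (coeff q k))

*-zeroʳ : ∀ p → p *ₚ [] ≋ []
*-zeroʳ []      = ≋-refl
*-zeroʳ (a ∷ p) = ≋-trans (∷-cong refl (*-zeroʳ p)) zero-const

-- Multiplication by a polynomial equal to zero gives zero; this is not
-- definitional, as zero has many coefficient lists.
*-annihilatorˡ : ∀ {p} q → p ≋ [] → p *ₚ q ≋ []
*-annihilatorˡ {[]}    q e = ≋-refl
*-annihilatorˡ {a ∷ p} q e with a≡0 , p≋[] ← ∷-vanish e = begin
    a ·ₚ q +ₚ (0ℤ ∷ p *ₚ q)   ≈⟨ +-cong (≋-trans (≡⇒≋ (cong (_·ₚ q) a≡0)) (·-zeroˡ q))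
                                        (∷-cong refl (*-annihilatorˡ q p≋[])) ⟩
    [] +ₚ const 0ℤ            ≈⟨ zero-const ⟩
    []                        ∎
  where open ≋-Reasoning

*-congʳ : ∀ p {q q′} → q ≋ q′ → p *ₚ q ≋ p *ₚ q′
*-congʳ []      e = ≋-refl
*-congʳ (a ∷ p) e = +-cong (·-cong a e) (∷-cong refl (*-congʳ p e))

*-congˡ : ∀ {p p′} q → p ≋ p′ → p *ₚ q ≋ p′ *ₚ q
*-congˡ {[]}    q e = ≋-sym (*-annihilatorˡ q (≋-sym e))
*-congˡ {a ∷ p} {[]} q e = *-annihilatorˡ q e
*-congˡ {a ∷ p} {b ∷ p′} q e with a≡b , p≋p′ ← ∷-split e =
  +-cong (≡⇒≋ (cong (_·ₚ q) a≡b)) (∷-cong refl (*-congˡ q p≋p′))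

*-cong : ∀ {p p′ q q′} → p ≋ p′ → q ≋ q′ → p *ₚ q ≋ p′ *ₚ q′
*-cong {p′ = p′} {q = q} e f = ≋-trans (*-congˡ q e) (*-congʳ p′ f)

const-* : ∀ a q → const a *ₚ q ≋ a ·ₚ q
const-* a q = ≋-trans (+-cong (≋-refl {a ·ₚ q}) zero-const) (≡⇒≋ (+-identityʳ (a ·ₚ q)))

*-identityʳ : ∀ p → p *ₚ const 1ℤ ≋ p
*-identityʳ []      = ≋-refl
*-identityʳ (a ∷ p) =
  ∷-cong (trans (ℤP.+-identityʳ (a ℤ.* 1ℤ)) (ℤP.*-identityʳ a)) (*-identityʳ p)

scaledX-* : ∀ a q → (0ℤ ∷ a ∷ []) *ₚ q ≋ 0ℤ ∷ a ·ₚ q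
scaledX-* a q = +-cong (·-zeroˡ q) (∷-cong refl (const-* a q))

X-* : ∀ q → X *ₚ q ≋ 0ℤ ∷ q
X-* q = ≋-trans (scaledX-* 1ℤ q) (∷-cong refl (·-identityˡ q))

xMinus1 : Poly
xMinus1 = X -ₚ const 1ℤ

monomial : ℤ → ℕ → Poly
monomial a zero    = const a
monomial a (suc d) = 0ℤ ∷ monomial a d

X^-monomial : ∀ m → X ^ₚ m ≋ monomial 1ℤ m
X^-monomial zero    = ≋-refl
X^-monomial (suc m) = ≋-trans (X-* (X ^ₚ m)) (∷-cong refl (X^-monomial m))

·-monomial : ∀ c a d → c ·ₚ monomial a d ≋ monomial (c ℤ.* a) d
·-monomial c a zero    = ≋-refl
·-monomial c a (suc d) = ∷-cong (ℤP.*-zeroʳ c) (·-monomial c a d)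

sgn : ℕ → ℤ
sgn zero          = 1ℤ
sgn (suc zero)    = -1ℤ
sgn (suc (suc k)) = sgn k

sign-const : ∀ k → sign k ≡ const (sgn k)
sign-const zero          = refl
sign-const (suc zero)    = refl
sign-const (suc (suc k)) = sign-const k

sgn-suc : ∀ k → sgn (suc k) ≡ ℤ.- sgn k
sgn-suc zero          = refl
sgn-suc (suc zero)    = refl
sgn-suc (suc (suc k)) = sgn-suc k

sgn-square : ∀ k → sgn k ℤ.* sgn k ≡ 1ℤ
sgn-square zero          = refl
sgn-square (suc zero)    = refl
sgn-square (suc (suc k)) = sgn-square k

-- The cofactor sign (−1)^(d+1) cancels the sign of the minor's
-- determinant (−1)^(d+1)·xᵈ, leaving −xᵈ after multiplying by the entry −1.
signed-monomial : ∀ d → sign (suc d) *ₚ const -1ℤ *ₚ monomial (sgn (suc d)) d ≋ monomial -1ℤ d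
signed-monomial d = begin
    sign (suc d) *ₚ const -1ℤ *ₚ monomial s d
      ≡⟨ cong (λ p → p *ₚ const -1ℤ *ₚ monomial s d) (sign-const (suc d)) ⟩
    const s *ₚ const -1ℤ *ₚ monomial s d        ≈⟨ *-congˡ (monomial s d) (const-* s (const -1ℤ)) ⟩
    const (s ℤ.* -1ℤ) *ₚ monomial s d           ≈⟨ const-* (s ℤ.* -1ℤ) (monomial s d) ⟩
    (s ℤ.* -1ℤ) ·ₚ monomial s d                 ≈⟨ ·-monomial (s ℤ.* -1ℤ) s d ⟩
    monomial (s ℤ.* -1ℤ ℤ.* s) d                ≡⟨ cong (λ a → monomial a d) square ⟩
    monomial -1ℤ d                              ∎
  where
  open ≋-Reasoning
  s = sgn (suc d)
  square : s ℤ.* -1ℤ ℤ.* s ≡ -1ℤ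
  square = trans (swap s) (cong ℤ.-_ (sgn-square (suc d)))
    where
    swap : ∀ a → a ℤ.* (ℤ.- 1ℤ) ℤ.* a ≡ ℤ.- (a ℤ.* a)
    swap = solve-∀

ΣFin-cong : ∀ {n} {f g : Fin n → Poly} → (∀ j → f j ≋ g j) → ΣFin f ≋ ΣFin g
ΣFin-cong {zero}  h = ≋-refl
ΣFin-cong {suc n} h = +-cong (h Fin.zero) (ΣFin-cong (λ j → h (Fin.suc j)))

ΣFin-vanish : ∀ {n} {f : Fin n → Poly} → (∀ j → f j ≋ []) → ΣFin f ≋ []
ΣFin-vanish {zero}  h = ≋-refl
ΣFin-vanish {suc n} h = +-cong (h Fin.zero) (ΣFin-vanish (λ j → h (Fin.suc j)))

ΣFin-single : ∀ {n} {f : Fin n → Poly} (k : Fin n) →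
              (∀ j → j ≢ k → f j ≋ []) → ΣFin f ≋ f k
ΣFin-single {suc n} {f} Fin.zero h = begin
    f Fin.zero +ₚ ΣFin (λ j → f (Fin.suc j))   ≈⟨ +-cong ≋-refl (ΣFin-vanish (λ j → h (Fin.suc j) λ ())) ⟩
    f Fin.zero +ₚ []                           ≡⟨ +-identityʳ (f Fin.zero) ⟩
    f Fin.zero                                 ∎
  where open ≋-Reasoning
ΣFin-single {suc n} (Fin.suc k) h =
  +-cong (h Fin.zero λ ()) (ΣFin-single k λ j j≢k → h (Fin.suc j) (j≢k ∘ FinP.suc-injective))

ΣFin-shift : ∀ {m} (f : Fin m → Poly) → ΣFin (λ j → 0ℤ ∷ f j) ≋ 0ℤ ∷ ΣFin f
ΣFin-shift {zero}  f = ≋-sym zero-const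
ΣFin-shift {suc m} f = +-cong (≋-refl {0ℤ ∷ f Fin.zero}) (ΣFin-shift (λ j → f (Fin.suc j)))

ΣFin-monomials : ∀ a m → ΣFin {m} (λ j → monomial a (toℕ j)) ≋ replicate m a
ΣFin-monomials a zero    = ≋-refl
ΣFin-monomials a (suc m) = begin
    const a +ₚ ΣFin {m} (λ j → 0ℤ ∷ monomial a (toℕ j))
      ≈⟨ +-cong (≋-refl {const a}) (ΣFin-shift {m} (λ j → monomial a (toℕ j))) ⟩
    (a ℤ.+ 0ℤ) ∷ ΣFin {m} (λ j → monomial a (toℕ j))
      ≈⟨ ∷-cong (ℤP.+-identityʳ a) (ΣFin-monomials a m) ⟩
    replicate (suc m) a ∎
  where open ≋-Reasoning

replicate-suc : ∀ a m → replicate (suc m) a ≋ monomial a m +ₚ replicate m a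
replicate-suc a zero    = ≋-refl
replicate-suc a (suc m) = ∷-cong (sym (ℤP.+-identityˡ a)) (replicate-suc a m)

xMinus1-*-sub : ∀ p r → xMinus1 *ₚ p -ₚ r ≋ (0ℤ ∷ p) -ₚ (p +ₚ r)
xMinus1-*-sub p r = ≋-trans (+-cong expand ≋-refl) (mk≋ λ k → begin
    coeff (-1ℤ ·ₚ p +ₚ (0ℤ ∷ p) -ₚ r) k
      ≡⟨ coeff-- (-1ℤ ·ₚ p +ₚ (0ℤ ∷ p)) r k ⟩
    coeff (-1ℤ ·ₚ p +ₚ (0ℤ ∷ p)) k ℤ.- coeff r k
      ≡⟨ cong (ℤ._- coeff r k) (trans (coeff-+ (-1ℤ ·ₚ p) (0ℤ ∷ p) k)
                                      (cong (ℤ._+ coeff (0ℤ ∷ p) k) (coeff-· -1ℤ p k))) ⟩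
    (-1ℤ ℤ.* coeff p k ℤ.+ coeff (0ℤ ∷ p) k) ℤ.- coeff r k
      ≡⟨ rearrange (coeff p k) (coeff (0ℤ ∷ p) k) (coeff r k) ⟩
    coeff (0ℤ ∷ p) k ℤ.- (coeff p k ℤ.+ coeff r k)
      ≡⟨ cong (ℤ._-_ (coeff (0ℤ ∷ p) k)) (coeff-+ p r k) ⟨
    coeff (0ℤ ∷ p) k ℤ.- coeff (p +ₚ r) k
      ≡⟨ coeff-- (0ℤ ∷ p) (p +ₚ r) k ⟨
    coeff ((0ℤ ∷ p) -ₚ (p +ₚ r)) k ∎)
  where
  open ≡-Reasoning
  expand : xMinus1 *ₚ p ≋ -1ℤ ·ₚ p +ₚ (0ℤ ∷ p)
  expand = +-cong ≋-refl (∷-cong refl (≋-trans (const-* 1ℤ p) (·-identityˡ p)))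
  rearrange : ∀ a b c → ((ℤ.- 1ℤ) ℤ.* a ℤ.+ b) ℤ.- c ≡ b ℤ.- (a ℤ.+ c)
  rearrange = solve-∀

geometric-telescope : ∀ T → xMinus1 *ₚ X ^ₚ T +ₚ replicate T -1ℤ
                            ≋ X ^ₚ suc T -ₚ replicate (suc T) 1ℤ
geometric-telescope T = begin
    xMinus1 *ₚ X ^ₚ T +ₚ replicate T -1ℤ
      ≡⟨ cong (xMinus1 *ₚ X ^ₚ T +ₚ_) (ListP.map-replicate ℤ.-_ T 1ℤ) ⟨
    xMinus1 *ₚ X ^ₚ T -ₚ replicate T 1ℤ
      ≈⟨ xMinus1-*-sub (X ^ₚ T) (replicate T 1ℤ) ⟩
    (0ℤ ∷ X ^ₚ T) -ₚ (X ^ₚ T +ₚ replicate T 1ℤ)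
      ≈⟨ +-cong (≋-sym (X-* (X ^ₚ T)))
                (neg-cong (≋-sym (≋-trans (replicate-suc 1ℤ T)
                                          (+-cong (≋-sym (X^-monomial T)) ≋-refl)))) ⟩
    X ^ₚ suc T -ₚ replicate (suc T) 1ℤ ∎
  where open ≋-Reasoning

ΣList-powers : ∀ m → ΣList (range 1 m) (λ i → X ^ₚ (m ∸ i)) ≋ replicate m 1ℤ
ΣList-powers zero    = ≋-refl
ΣList-powers (suc m) = begin
    X ^ₚ m +ₚ ΣList (range 2 m) (λ i → X ^ₚ (suc m ∸ i))
      ≡⟨ cong (X ^ₚ m +ₚ_) (shift 1 m (λ i → X ^ₚ (suc m ∸ i))) ⟩
    X ^ₚ m +ₚ ΣList (range 1 m) (λ i → X ^ₚ (m ∸ i))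
      ≈⟨ +-cong (X^-monomial m) (ΣList-powers m) ⟩
    monomial 1ℤ m +ₚ replicate m 1ℤ
      ≈⟨ replicate-suc 1ℤ m ⟨
    replicate (suc m) 1ℤ ∎
  where
  open ≋-Reasoning
  shift : ∀ a k (f : ℕ → Poly) → ΣList (range (suc a) k) f ≡ ΣList (range a k) (f ∘ suc)
  shift a zero    f = refl
  shift a (suc k) f = cong (f (suc a) +ₚ_) (shift (suc a) k f)

ΠFin : ∀ {n} → (Fin n → Poly) → Poly
ΠFin {zero}  f = const 1ℤ
ΠFin {suc n} f = f Fin.zero *ₚ ΠFin (λ i → f (Fin.suc i))

ΠFin-const : ∀ {n} {f : Fin n → Poly} p → (∀ i → f i ≋ p) → ΠFin f ≋ p ^ₚ n
ΠFin-const {zero}  p h = ≋-refl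
ΠFin-const {suc n} p h = *-cong (h Fin.zero) (ΠFin-const p (λ i → h (Fin.suc i)))

-- Square matrices of polynomials.  The minor  minor M j  deletes row 0
-- and column j, exactly as in the cofactor expansion defining  det, so
-- that  det M  is definitionally  ΣFin (cofactor M).

Mat : ℕ → Set
Mat n = Fin n → Fin n → Poly

minor : ∀ {n} → Mat (suc n) → Fin (suc n) → Mat n
minor M j r c = M (Fin.suc r) (punchIn j c)

cofactor : ∀ {n} → Mat (suc n) → Fin (suc n) → Poly
cofactor M j = sign (toℕ j) *ₚ M Fin.zero j *ₚ det (minor M j)

det-cong : ∀ {n} {M N : Mat n} → (∀ r c → M r c ≋ N r c) → det M ≋ det N
det-cong {zero}  h = ≋-refl
det-cong {suc n} h = ΣFin-cong λ j →
  *-cong (*-congʳ (sign (toℕ j)) (h Fin.zero j)) (det-cong (λ r c → h (Fin.suc r) (punchIn j c)))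

cofactor-entry0 : ∀ {n} (M : Mat (suc n)) j → M Fin.zero j ≋ [] → cofactor M j ≋ []
cofactor-entry0 M j e =
  *-annihilatorˡ (det (minor M j)) (≋-trans (*-congʳ (sign (toℕ j)) e) (*-zeroʳ (sign (toℕ j))))

cofactor-minor0 : ∀ {n} (M : Mat (suc n)) j → det (minor M j) ≋ [] → cofactor M j ≋ []
cofactor-minor0 M j e = ≋-trans (*-congʳ signedEntry e) (*-zeroʳ signedEntry)
  where signedEntry = sign (toℕ j) *ₚ M Fin.zero j

minor-column : ∀ {n} (M : Mat (suc n)) {j k} (j≢k : j ≢ k) r →
               minor M j r (punchOut j≢k) ≡ M (Fin.suc r) k
minor-column M j≢k r = cong (M (Fin.suc r)) (FinP.punchIn-punchOut j≢k)

det-zeroColumn : ∀ {n} (M : Mat n) k → (∀ r → M r k ≋ []) → det M ≋ []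
det-zeroColumn {suc n} M k h = ΣFin-vanish vanish
  where
  vanish : ∀ j → cofactor M j ≋ []
  vanish j with j Fin.≟ k
  ... | yes refl = cofactor-entry0 M j (h Fin.zero)
  ... | no  j≢k  = cofactor-minor0 M j
        (det-zeroColumn (minor M j) (punchOut j≢k)
          (λ r → ≋-trans (≡⇒≋ (minor-column M j≢k r)) (h (Fin.suc r))))

det-expandColumn : ∀ {n} (M : Mat (suc n)) k → (∀ r → M (Fin.suc r) k ≋ []) →
                   det M ≋ cofactor M k
det-expandColumn M k h = ΣFin-single k λ j j≢k → cofactor-minor0 M j
  (det-zeroColumn (minor M j) (punchOut j≢k)
    (λ r → ≋-trans (≡⇒≋ (minor-column M j≢k r)) (h r)))

det-expandRow : ∀ {n} (M : Mat (suc n)) k → (∀ j → j ≢ k → M Fin.zero j ≋ []) →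
                det M ≋ cofactor M k
det-expandRow M k h = ΣFin-single k λ j j≢k → cofactor-entry0 M j (h j j≢k)

det-1×1 : (M : Mat 1) → det M ≋ M Fin.zero Fin.zero
det-1×1 M = begin
    const 1ℤ *ₚ M₀₀ *ₚ const 1ℤ +ₚ []   ≡⟨ +-identityʳ _ ⟩
    const 1ℤ *ₚ M₀₀ *ₚ const 1ℤ         ≈⟨ *-identityʳ _ ⟩
    const 1ℤ *ₚ M₀₀                     ≈⟨ const-* 1ℤ M₀₀ ⟩
    1ℤ ·ₚ M₀₀                           ≈⟨ ·-identityˡ M₀₀ ⟩
    M₀₀                                 ∎
  where
  open ≋-Reasoning
  M₀₀ = M Fin.zero Fin.zero

det-upperTriangular : ∀ {n} (M : Mat n) → (∀ r c → toℕ c < toℕ r → M r c ≋ []) →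
                      det M ≋ ΠFin (λ i → M i i)
det-upperTriangular {zero}  M h = ≋-refl
det-upperTriangular {suc n} M h = begin
    det M                                  ≈⟨ det-expandColumn M Fin.zero (λ r → h (Fin.suc r) Fin.zero (s≤s z≤n)) ⟩
    const 1ℤ *ₚ M₀₀ *ₚ det (minor M Fin.zero)
      ≈⟨ *-cong (≋-trans (const-* 1ℤ M₀₀) (·-identityˡ M₀₀))
                (det-upperTriangular (minor M Fin.zero) (λ r c c<r → h (Fin.suc r) (Fin.suc c) (s≤s c<r))) ⟩
    ΠFin (λ i → M i i)                     ∎
  where
  open ≋-Reasoning
  M₀₀ = M Fin.zero Fin.zero

-- A minor of such a matrix is again of this form
-- (definitionally), which is how all minors below are tracked.

relabel : ∀ {n} → (ℕ → ℕ → Poly) → (Fin n → ℕ) → (Fin n → ℕ) → Mat n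
relabel e ρ κ r c = e (ρ r) (κ c)

det-relabel : ∀ {n} (e : ℕ → ℕ → Poly) {ρ ρ′ κ κ′ : Fin n → ℕ} →
              (∀ r → ρ r ≡ ρ′ r) → (∀ c → κ c ≡ κ′ c) →
              det (relabel e ρ κ) ≋ det (relabel e ρ′ κ′)
det-relabel e hρ hκ = det-cong λ r c → ≡⇒≋ (cong₂ e (hρ r) (hκ c))

punchInℕ : ℕ → ℕ → ℕ
punchInℕ zero    c       = suc c
punchInℕ (suc d) zero    = zero
punchInℕ (suc d) (suc c) = suc (punchInℕ d c)

toℕ-punchIn : ∀ {m} (j : Fin (suc m)) (c : Fin m) → toℕ (punchIn j c) ≡ punchInℕ (toℕ j) (toℕ c)
toℕ-punchIn Fin.zero    c        = refl
toℕ-punchIn (Fin.suc j) Fin.zero = refl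
toℕ-punchIn (Fin.suc j) (Fin.suc c) = cong suc (toℕ-punchIn j c)

rowsFrom : ∀ {s} → ℕ → Fin s → ℕ
rowsFrom m r = toℕ r ℕ.+ m

colsSkipping : ∀ {s} → ℕ → ℕ → Fin (suc s) → ℕ
colsSkipping m d Fin.zero    = 0
colsSkipping m d (Fin.suc c) = punchInℕ d (toℕ c) ℕ.+ m

minor-skipping : ∀ s (e : ℕ → ℕ → Poly) m d →
  det (minor (relabel {suc (suc s)} e (rowsFrom m) (colsSkipping m d)) (Fin.suc Fin.zero))
    ≋ det (relabel e (rowsFrom {suc s} (suc m)) (colsSkipping (suc m) (ℕ.pred d)))
minor-skipping s e m d = det-relabel {suc s} e (λ r → sym (ℕP.+-suc (toℕ r) m)) (columns d)
  where
  columns : ∀ d (c : Fin (suc s)) →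
            colsSkipping m d (punchIn (Fin.suc Fin.zero) c) ≡ colsSkipping (suc m) (ℕ.pred d) c
  columns d       Fin.zero    = refl
  columns zero    (Fin.suc c) = sym (ℕP.+-suc (suc (toℕ c)) m)
  columns (suc d) (Fin.suc c) = sym (ℕP.+-suc (punchInℕ d (toℕ c)) m)

-- Multiplicity of an arc in a list of arcs.  The adjacency matrix of a
-- digraph counts arcs in exactly this way.

count : List (ℕ × ℕ) → ℕ × ℕ → ℕ
count L v = length (filter (λ e → ≡-dec ℕP._≟_ ℕP._≟_ e v) L)

count-hit : ∀ L v → count (v ∷ L) v ≡ suc (count L v)
count-hit L v = cong length (ListP.filter-accept (λ e → ≡-dec ℕP._≟_ ℕP._≟_ e v) refl)

count-miss : ∀ {x} L v → x ≢ v → count (x ∷ L) v ≡ count L v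
count-miss L v x≢v = cong length (ListP.filter-reject (λ e → ≡-dec ℕP._≟_ ℕP._≟_ e v) x≢v)

count-++ : ∀ xs ys v → count (xs ++ ys) v ≡ count xs v ℕ.+ count ys v
count-++ xs ys v = trans (cong length (ListP.filter-++ (λ e → ≡-dec ℕP._≟_ ℕP._≟_ e v) xs ys))
                         (ListP.length-++ (filter (λ e → ≡-dec ℕP._≟_ ℕP._≟_ e v) xs))

count-absent : ∀ (f : ℕ → ℕ × ℕ) a k v → (∀ i → a ≤ i → i < a ℕ.+ k → f i ≢ v) →
               count (map f (range a k)) v ≡ 0
count-absent f a zero    v h = refl
count-absent f a (suc k) v h =
  trans (count-miss (map f (range (suc a) k)) v (h a ℕP.≤-refl (ℕP.m<m+n a (s≤s z≤n))))
        (count-absent f (suc a) k v λ i a<i i<1+a+k →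
          h i (ℕP.<⇒≤ a<i) (subst (i <_) (sym (ℕP.+-suc a k)) i<1+a+k))

count-once : ∀ (f : ℕ → ℕ × ℕ) → (∀ {i j} → f i ≡ f j → i ≡ j) → ∀ a k i →
             a ≤ i → i < a ℕ.+ k → count (map f (range a k)) (f i) ≡ 1
count-once f inj a zero    i a≤i i<a+0 =
  ⊥-elim (ℕP.<⇒≱ i<a+0 (subst (_≤ i) (sym (ℕP.+-identityʳ a)) a≤i))
count-once f inj a (suc k) i a≤i i<a+1+k with a ℕ.≟ i
... | yes refl = trans (count-hit (map f (range (suc a) k)) (f a))
  (cong suc (count-absent f (suc a) k (f a) λ j a<j _ fj≡fa → ℕP.<⇒≢ a<j (sym (inj fj≡fa))))
... | no  a≢i  = trans (count-miss (map f (range (suc a) k)) (f i) (a≢i ∘ inj))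
  (count-once f inj (suc a) k i (ℕP.≤∧≢⇒< a≤i a≢i) (subst (i <_) (ℕP.+-suc a k) i<a+1+k))

does-toℕ : ∀ {m} (i j : Fin m) → does (i Fin.≟ j) ≡ does (toℕ i ℕ.≟ toℕ j)
does-toℕ i j with i Fin.≟ j
... | yes refl = sym (dec-true (toℕ i ℕ.≟ toℕ i) refl)
... | no  i≢j  = sym (dec-false (toℕ i ℕ.≟ toℕ j) (i≢j ∘ FinP.toℕ-injective))

-- The matrix xI − A of PDFₙ for n = q + 3.  Vertex v is given the label
-- v − 1 ∈ {0, …, T}, T = n − 1, as in the adjacency matrix.

module PDF-matrix (q : ℕ) where

  n T : ℕ
  n = suc (suc (suc q))
  T = suc (suc q)

  pathArc sourceArc : ℕ → ℕ × ℕ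
  pathArc t   = (t , suc t)
  sourceArc i = (1 , i)

  pathArcs sourceArcs returnArc : List (ℕ × ℕ)
  pathArcs   = map pathArc (range 2 (suc q))
  sourceArcs = map sourceArc (range 1 n)
  returnArc  = (n , 1) ∷ []

  arcCount : ℕ → ℕ → ℕ
  arcCount i j = count (Digraph.arcs (PDF n)) (suc i , suc j)

  arcCount-split : ∀ i j → arcCount i j ≡
    count pathArcs (suc i , suc j) ℕ.+ (count sourceArcs (suc i , suc j) ℕ.+ count returnArc (suc i , suc j))
  arcCount-split i j = trans (count-++ pathArcs (sourceArcs ++ returnArc) (suc i , suc j))
    (cong (count pathArcs (suc i , suc j) ℕ.+_) (count-++ sourceArcs returnArc (suc i , suc j)))

  path-away : ∀ u v → v ≢ suc u → count pathArcs (u , v) ≡ 0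
  path-away u v v≢1+u = count-absent pathArc 2 (suc q) (u , v) λ t _ _ e →
    v≢1+u (trans (sym (cong proj₂ e)) (cong (suc ∘ proj₁) e))

  path-source : ∀ v → count pathArcs (1 , v) ≡ 0
  path-source v = count-absent pathArc 2 (suc q) (1 , v) λ t 2≤t _ e → ℕP.<⇒≢ 2≤t (sym (cong proj₁ e))

  path-last : ∀ v → count pathArcs (n , v) ≡ 0
  path-last v = count-absent pathArc 2 (suc q) (n , v) λ t _ t<n e → ℕP.<⇒≢ t<n (cong proj₁ e)

  path-next : ∀ u → 2 ≤ u → u < n → count pathArcs (u , suc u) ≡ 1
  path-next u = count-once pathArc (cong proj₁) 2 (suc q) u

  source-away : ∀ u v → u ≢ 1 → count sourceArcs (u , v) ≡ 0
  source-away u v u≢1 = count-absent sourceArc 1 n (u , v) λ i _ _ e → u≢1 (sym (cong proj₁ e))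

  source-hit : ∀ v → 1 ≤ v → v ≤ n → count sourceArcs (1 , v) ≡ 1
  source-hit v 1≤v v≤n = count-once sourceArc (cong proj₂) 1 n v 1≤v (s≤s v≤n)

  return-away : ∀ u v → (n , 1) ≢ (u , v) → count returnArc (u , v) ≡ 0
  return-away u v = count-miss [] (u , v)

  arcCount-source : ∀ j → j < n → arcCount 0 j ≡ 1
  arcCount-source j j<n = trans (arcCount-split 0 j)
    (cong₂ ℕ._+_ (path-source (suc j))
      (cong₂ ℕ._+_ (source-hit (suc j) (s≤s z≤n) j<n)
                   (return-away 1 (suc j) λ e → n≢1 (cong proj₁ e))))
    where n≢1 : n ≢ 1
          n≢1 ()

  arcCount-path : ∀ i j → 1 ≤ i → i < T →
                  arcCount i j ≡ count pathArcs (suc i , suc j)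
  arcCount-path i j 1≤i i<T = trans (arcCount-split i j)
    (trans (cong (count pathArcs (suc i , suc j) ℕ.+_)
             (cong₂ ℕ._+_ (source-away (suc i) (suc j) λ e → ℕP.<⇒≢ (s≤s 1≤i) (sym e))
                          (return-away (suc i) (suc j) λ e → ℕP.<⇒≢ (s≤s i<T) (sym (cong proj₁ e)))))
           (ℕP.+-identityʳ _))

  arcCount-next : ∀ i → 1 ≤ i → i < T → arcCount i (suc i) ≡ 1
  arcCount-next i 1≤i i<T = trans (arcCount-path i (suc i) 1≤i i<T) (path-next (suc i) (s≤s 1≤i) (s≤s i<T))

  arcCount-notNext : ∀ i j → 1 ≤ i → i < T → j ≢ suc i → arcCount i j ≡ 0
  arcCount-notNext i j 1≤i i<T j≢1+i = trans (arcCount-path i j 1≤i i<T)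
    (path-away (suc i) (suc j) (j≢1+i ∘ ℕP.suc-injective))

  arcCount-last : ∀ j → arcCount T j ≡ count returnArc (n , suc j)
  arcCount-last j = trans (arcCount-split T j)
    (cong₂ ℕ._+_ (path-last (suc j)) (cong (ℕ._+ count returnArc (n , suc j)) (source-away n (suc j) λ ())))

  arcCount-return : arcCount T 0 ≡ 1
  arcCount-return = trans (arcCount-last 0) (count-hit [] (n , 1))

  arcCount-notReturn : ∀ j → j ≢ 0 → arcCount T j ≡ 0
  arcCount-notReturn j j≢0 = trans (arcCount-last j)
    (return-away n (suc j) λ e → j≢0 (ℕP.suc-injective (sym (cong proj₂ e))))

  entry : ℕ → ℕ → Poly
  entry i j = (if does (i ℕ.≟ j) then X else []) -ₚ const (+ arcCount i j)

  entry-onDiagonal : ∀ i {k} → arcCount i i ≡ k → entry i i ≡ X -ₚ const (+ k)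
  entry-onDiagonal i h rewrite dec-true (i ℕ.≟ i) refl | h = refl

  entry-offDiagonal : ∀ i j {k} → i ≢ j → arcCount i j ≡ k → entry i j ≡ [] -ₚ const (+ k)
  entry-offDiagonal i j i≢j h rewrite dec-false (i ℕ.≟ j) i≢j | h = refl

  entry-00 : entry 0 0 ≡ xMinus1
  entry-00 = entry-onDiagonal 0 (arcCount-source 0 (s≤s z≤n))

  entry-source : ∀ c → 1 ≤ c → c < n → entry 0 c ≡ const -1ℤ
  entry-source c 1≤c c<n = entry-offDiagonal 0 c (ℕP.<⇒≢ 1≤c) (arcCount-source c c<n)

  entry-diagonal : ∀ i → 1 ≤ i → i ≤ T → entry i i ≡ X
  entry-diagonal i 1≤i i≤T with ℕP.m≤n⇒m<n∨m≡n i≤T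
  ... | inj₁ i<T = entry-onDiagonal i (arcCount-notNext i i 1≤i i<T (ℕP.1+n≢n ∘ sym))
  ... | inj₂ refl = entry-onDiagonal T (arcCount-notReturn T λ ())

  entry-next : ∀ i → 1 ≤ i → i < T → entry i (suc i) ≡ const -1ℤ
  entry-next i 1≤i i<T = entry-offDiagonal i (suc i) (ℕP.1+n≢n ∘ sym) (arcCount-next i 1≤i i<T)

  entry-return : entry T 0 ≡ const -1ℤ
  entry-return = entry-offDiagonal T 0 (λ ()) arcCount-return

  entry-pathZero : ∀ i c → 1 ≤ i → i < T → c ≢ i → c ≢ suc i → entry i c ≋ []
  entry-pathZero i c 1≤i i<T c≢i c≢1+i =
    ≋-trans (≡⇒≋ (entry-offDiagonal i c (c≢i ∘ sym) (arcCount-notNext i c 1≤i i<T c≢1+i))) zero-const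

  entry-below : ∀ i c → 1 ≤ c → c < i → i ≤ T → entry i c ≋ []
  entry-below i c 1≤c c<i i≤T with ℕP.m≤n⇒m<n∨m≡n i≤T
  ... | inj₁ i<T = entry-pathZero i c (ℕP.≤-trans 1≤c (ℕP.<⇒≤ c<i)) i<T
                     (ℕP.<⇒≢ c<i) (ℕP.<⇒≢ (ℕP.m<n⇒m<1+n c<i))
  ... | inj₂ refl = ≋-trans (≡⇒≋ (entry-offDiagonal T c (ℕP.>⇒≢ c<i)
                              (arcCount-notReturn c λ c≡0 → ℕP.<⇒≢ 1≤c (sym c≡0))))
                            zero-const

  matrix : Mat n
  matrix = relabel entry toℕ toℕ

  charPoly-matrix : charPoly (PDF n) ≋ det matrix
  charPoly-matrix = det-cong {n} λ i j → ≡⇒≋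
    (cong (λ b → (if b then X else []) -ₚ const (+ arcCount (toℕ i) (toℕ j))) (does-toℕ i j))

  det-leadingMinor : det (minor matrix Fin.zero) ≋ X ^ₚ T
  det-leadingMinor = ≋-trans
    (det-upperTriangular (minor matrix Fin.zero) λ r c c<r →
      entry-below (suc (toℕ r)) (suc (toℕ c)) (s≤s z≤n) (s≤s c<r) (FinP.toℕ<n r))
    (ΠFin-const X λ i → ≡⇒≋ (entry-diagonal (suc (toℕ i)) (s≤s z≤n) (FinP.toℕ<n i)))

  -- Peel off its first row:
  -- for d > 0 column m is zero except for x in row m; for d = 0 row m is
  -- zero except for −1 in column m + 1.  What remains is −1 in row T,
  -- column 0.
  det-skipMinor : ∀ d s m → 1 ≤ m → s ℕ.+ m ≡ T → d ≤ s →
    det (relabel {suc s} entry (rowsFrom m) (colsSkipping m d)) ≋ monomial (sgn (suc d)) d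
  det-skipMinor zero zero m _ size _ =
    ≋-trans (det-1×1 (relabel entry (rowsFrom m) (colsSkipping m 0)))
            (≡⇒≋ (trans (cong (λ i → entry i 0) size) entry-return))
  det-skipMinor zero (suc s) m 1≤m size _ = begin
      det N
        ≈⟨ det-expandRow N (Fin.suc Fin.zero) row-m ⟩
      sign 1 *ₚ entry m (suc m) *ₚ det (minor N (Fin.suc Fin.zero))
        ≈⟨ *-cong (≡⇒≋ (cong (sign 1 *ₚ_) (entry-next m 1≤m m<T)))
                  (≋-trans (minor-skipping s entry m 0)
                           (det-skipMinor 0 s (suc m) (s≤s z≤n) (trans (ℕP.+-suc s m) size) z≤n)) ⟩
      sign 1 *ₚ const -1ℤ *ₚ const -1ℤ
        ≡⟨⟩
      const -1ℤ ∎
    where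
    open ≋-Reasoning
    N : Mat (suc (suc s))
    N = relabel entry (rowsFrom m) (colsSkipping m 0)
    m<T : m < T
    m<T = subst (m <_) size (s≤s (ℕP.m≤n+m m s))
    row-m : ∀ c → c ≢ Fin.suc Fin.zero → N Fin.zero c ≋ []
    row-m Fin.zero _ = entry-pathZero m 0 1≤m m<T (ℕP.<⇒≢ 1≤m) λ ()
    row-m (Fin.suc Fin.zero) c≢1 = ⊥-elim (c≢1 refl)
    row-m (Fin.suc (Fin.suc c)) _ = entry-pathZero m _ 1≤m m<T
      (ℕP.m≢1+n+m m ∘ sym) (ℕP.m≢1+n+m m ∘ sym ∘ ℕP.suc-injective)
  det-skipMinor (suc d) zero m _ _ ()
  det-skipMinor (suc d) (suc s) m 1≤m size (s≤s d≤s) = begin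
      det N
        ≈⟨ det-expandColumn N (Fin.suc Fin.zero) column-m ⟩
      sign 1 *ₚ entry m m *ₚ det (minor N (Fin.suc Fin.zero))
        ≈⟨ *-cong (≡⇒≋ (cong (sign 1 *ₚ_) (entry-diagonal m 1≤m (ℕP.<⇒≤ m<T))))
                  (≋-trans (minor-skipping s entry m (suc d))
                           (det-skipMinor d s (suc m) (s≤s z≤n) (trans (ℕP.+-suc s m) size) d≤s)) ⟩
      sign 1 *ₚ X *ₚ monomial (sgn (suc d)) d
        ≡⟨⟩
      (0ℤ ∷ -1ℤ ∷ []) *ₚ monomial (sgn (suc d)) d
        ≈⟨ scaledX-* -1ℤ _ ⟩
      0ℤ ∷ -1ℤ ·ₚ monomial (sgn (suc d)) d
        ≈⟨ ∷-cong refl (·-monomial -1ℤ (sgn (suc d)) d) ⟩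
      0ℤ ∷ monomial (-1ℤ ℤ.* sgn (suc d)) d
        ≡⟨ cong (λ a → 0ℤ ∷ monomial a d) (trans (ℤP.-1*i≡-i _) (sym (sgn-suc (suc d)))) ⟩
      monomial (sgn (suc (suc d))) (suc d) ∎
    where
    open ≋-Reasoning
    N : Mat (suc (suc s))
    N = relabel entry (rowsFrom m) (colsSkipping m (suc d))
    m<T : m < T
    m<T = subst (m <_) size (s≤s (ℕP.m≤n+m m s))
    column-m : ∀ r → N (Fin.suc r) (Fin.suc Fin.zero) ≋ []
    column-m r = entry-below _ m 1≤m (s≤s (ℕP.m≤n+m m (toℕ r)))
      (subst (suc (toℕ r ℕ.+ m) ≤_) size (ℕP.+-monoˡ-≤ m (FinP.toℕ<n r)))

  leading-cofactor : cofactor matrix Fin.zero ≋ xMinus1 *ₚ X ^ₚ T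
  leading-cofactor = *-cong
    (≋-trans (const-* 1ℤ (entry 0 0)) (≋-trans (·-identityˡ (entry 0 0)) (≡⇒≋ entry-00)))
    det-leadingMinor

  -- Column d + 1 contributes −xᵈ: its minor is the skipping minor with
  -- m = 1, up to relabelling.
  other-cofactor : ∀ (j : Fin T) → cofactor matrix (Fin.suc j) ≋ monomial -1ℤ (toℕ j)
  other-cofactor j = ≋-trans
    (*-cong (≡⇒≋ (cong (sign (suc d) *ₚ_) (entry-source (suc d) (s≤s z≤n) (s≤s (FinP.toℕ<n j)))))
            (≋-trans (det-relabel {T} entry rows columns)
                     (det-skipMinor d (suc q) 1 (s≤s z≤n) (ℕP.+-comm (suc q) 1) (ℕP.≤-pred (FinP.toℕ<n j)))))
    (signed-monomial d)
    where
    d = toℕ j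
    rows : ∀ (r : Fin T) → suc (toℕ r) ≡ rowsFrom 1 r
    rows r = ℕP.+-comm 1 (toℕ r)
    columns : ∀ c → toℕ (punchIn (Fin.suc j) c) ≡ colsSkipping 1 d c
    columns Fin.zero    = refl
    columns (Fin.suc c) = trans (cong suc (toℕ-punchIn j c)) (ℕP.+-comm 1 _)

  det-matrix : det matrix ≋ xMinus1 *ₚ X ^ₚ T +ₚ replicate T -1ℤ
  det-matrix = +-cong leading-cofactor
    (≋-trans (ΣFin-cong other-cofactor) (ΣFin-monomials -1ℤ T))

mainTheorem5 : (n : ℕ) → n ≥ 3 →
    charPoly (PDF n) ≈ₚ ((X ^ₚ n) -ₚ ΣList (range 1 n) (λ i → X ^ₚ (n ∸ i)))
mainTheorem5 zero                ()
mainTheorem5 (suc zero)          (s≤s ())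
mainTheorem5 (suc (suc zero))    (s≤s (s≤s ()))
mainTheorem5 (suc (suc (suc q))) _ = ≋⇒≈ₚ (begin
    charPoly (PDF n)                          ≈⟨ charPoly-matrix ⟩
    det matrix                                ≈⟨ det-matrix ⟩
    xMinus1 *ₚ X ^ₚ T +ₚ replicate T -1ℤ      ≈⟨ geometric-telescope T ⟩
    X ^ₚ n -ₚ replicate n 1ℤ                  ≈⟨ +-cong ≋-refl (neg-cong (ΣList-powers n)) ⟨
    X ^ₚ n -ₚ ΣList (range 1 n) (λ i → X ^ₚ (n ∸ i)) ∎)
  where
  open PDF-matrix q
  open ≋-Reasoning
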